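{- Let $p>3$ be a prime, $t\in \{1,3,p,3p\}$, and $1\leqslant r\leqslant 3p-1$ with $\gcd(r,3p)=1$. Then $\mathcal{S}(3p,r,t)=3p$.
   Context: $\phi$ is Euler's totient function; $|r|_m$ is the multiplicative order of $r$ modulo $m$. $S_k(x)=1+x+\cdots+x^{k-1}$ for $k\ge1$, $S_0(x)=0$; for a positive integer $m$ with $\gcd(r,m)=1$, $\kappa(m,r,t)=\dfrac{m|r|_m}{\gcd(m,\ tS_{|r|_m}(r))}$. For a divisor $d$ of $3p$, $\Lambda(d,r,t)=\{\ell>0\mid \ell \text{ divides } \frac{|r|_{3p}}{\gcd(\kappa(d,r,t),|r|_{3p})} \text{ and } \gcd(r^{\ell\kappa(d,r,t)}-1,3p)=d\}$ and $\mathcal{S}(d,r,t)=\sum_{\ell\in \Lambda(d,r,t)} d\,\phi\!\left(\frac{|r|_{3p}}{\ell \gcd(\kappa(d,r,t),|r|_{3p})}\right)$. -}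

module Defs where

open import Data.Nat using (ℕ; zero; suc; _+_; _*_; _∸_; _^_; _≡ᵇ_; _<ᵇ_)
open import Data.Nat.DivMod using (_/_; _%_)
open import Data.Nat.GCD using (gcd)
open import Data.Bool using (Bool; true; false; _∧_; if_then_else_)
open import Data.List using (List; []; _∷_; map; length; filterᵇ; upTo)
open import Data.Nat.ListAction using (sum)

-- natural division with the convention n // 0 = 0 (only used with positive divisors)
_//_ : ℕ → ℕ → ℕ
n // zero = 0
n // suc d = n / suc d

_∣ᵇ_ : ℕ → ℕ → Bool
zero ∣ᵇ n = n ≡ᵇ 0
suc d ∣ᵇ n = (n % suc d) ≡ᵇ 0

oneTo : ℕ → List ℕ
oneTo n = map suc (upTo n)

firstᵇ : (ℕ → Bool) → List ℕ → ℕ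
firstᵇ P [] = 0
firstᵇ P (x ∷ xs) = if P x then x else firstᵇ P xs

-- multiplicative order |r|_m : least k ≥ 1 with r^k ≡ 1 (mod m).
-- For gcd(r,m)=1, m ≥ 1, such k exists and k ≤ φ(m) ≤ m, so the search over [1..m] finds it.
ord : ℕ → ℕ → ℕ
ord m r = firstᵇ (λ k → ((r ^ k) % suc (m ∸ 1)) ≡ᵇ (1 % suc (m ∸ 1))) (oneTo m)

φ : ℕ → ℕ
φ n = length (filterᵇ (λ k → gcd k n ≡ᵇ 1) (oneTo n))

Sgeom : ℕ → ℕ → ℕ
Sgeom zero x = 0
Sgeom (suc k) x = Sgeom k x + x ^ k

κ : ℕ → ℕ → ℕ → ℕ
κ m r t = (m * ord m r) // gcd m (t * Sgeom (ord m r) r)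

-- Throughout, n plays the role of 3p.
-- N(d,r,t) = |r|_n / gcd(κ(d,r,t), |r|_n)
Nbound : ℕ → ℕ → ℕ → ℕ → ℕ
Nbound n d r t = ord n r // gcd (κ d r t) (ord n r)

Λ : ℕ → ℕ → ℕ → ℕ → List ℕ
Λ n d r t = filterᵇ (λ ℓ → (ℓ ∣ᵇ Nbound n d r t) ∧ (gcd ((r ^ (ℓ * κ d r t)) ∸ 1) n ≡ᵇ d))
                    (oneTo (Nbound n d r t))

𝒮 : ℕ → ℕ → ℕ → ℕ → ℕ
𝒮 n d r t = sum (map (λ ℓ → d * φ (ord n r // (ℓ * gcd (κ d r t) (ord n r)))) (Λ n d r t))

{-# OPTIONS --safe #-}
module Submission where

-- Write k = |r|_{3p}. As gcd(3p, t S_k(r)) divides 3p, κ(3p,r,t) = 3p k / gcd(3p, t S_k(r)) is a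
-- multiple of k, so gcd(κ, k) = k and the only candidate for ℓ ∈ Λ(3p,r,t) is ℓ = 1. Since also
-- r^κ ≡ 1 (mod 3p), gcd(r^κ − 1, 3p) = 3p, hence Λ(3p,r,t) = {1} and 𝒮(3p,r,t) = 3p φ(1) = 3p.
-- Only 3p ≥ 1, r ≥ 1 and gcd(r, 3p) = 1 are used, so the argument runs for an arbitrary modulus m.
-- The search defining |r|_m succeeds because by pigeonhole two of r⁰, …, rᵐ agree mod m, and
-- cancelling the smaller power (coprime to m) gives r^s ≡ 1 with 1 ≤ s ≤ m.

open import Defs
open import Data.Bool using (Bool; true; false; T; _∧_)
open import Data.Empty using (⊥-elim)
open import Data.Fin using (toℕ; fromℕ<)
open import Data.Fin.Properties using (pigeonhole; toℕ-fromℕ<; toℕ<n)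
open import Data.List using ([]; _∷_; map; filterᵇ)
open import Data.List.Membership.Propositional using (_∈_)
open import Data.List.Membership.Propositional.Properties using (∈-map⁺; ∈-map⁻; ∈-upTo⁺)
open import Data.List.Relation.Unary.Any using (here; there)
open import Data.Nat using (ℕ; zero; suc; _+_; _*_; _∸_; _^_; _≤_; _<_; _≡ᵇ_; NonZero; z≤n; s≤s; s≤s⁻¹; >-nonZero)
open import Data.Nat.Coprimality as Coprimality using (Coprime; gcd≡1⇒coprime; coprime-divisor)
open import Data.Nat.DivMod
open import Data.Nat.Divisibility
open import Data.Nat.GCD using (gcd; gcd-GCD; gcd[m,n]∣m; gcd[m,n]≢0; module GCD)
open import Data.Nat.ListAction using (sum)
open import Data.Nat.Primality using (Prime)
open import Data.Nat.Properties
open import Data.Product using (Σ; _×_; _,_; proj₁; proj₂)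
open import Data.Sum using (_⊎_; inj₁)
open import Function using (_∘_)
open import Relation.Binary.PropositionalEquality
open import Relation.Nullary using (contradiction)

%≡⇒∣∸ : ∀ m x y .{{_ : NonZero m}} → x % m ≡ y % m → m ∣ x ∸ y
%≡⇒∣∸ m x y x≡y = divides (x / m ∸ y / m) (begin
  x ∸ y                                     ≡⟨ cong₂ _∸_ (m≡m%n+[m/n]*n x m) (m≡m%n+[m/n]*n y m) ⟩
  (x % m + x / m * m) ∸ (y % m + y / m * m) ≡⟨ cong (λ z → (x % m + x / m * m) ∸ (z + y / m * m)) x≡y ⟨
  (x % m + x / m * m) ∸ (x % m + y / m * m) ≡⟨ [m+n]∸[m+o]≡n∸o (x % m) _ _ ⟩
  x / m * m ∸ y / m * m                     ≡⟨ *-distribʳ-∸ m (x / m) (y / m) ⟨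
  (x / m ∸ y / m) * m                       ∎)
  where open ≡-Reasoning

∣∸⇒%≡ : ∀ m {x y} .{{_ : NonZero m}} → y ≤ x → m ∣ x ∸ y → x % m ≡ y % m
∣∸⇒%≡ m {x} {y} y≤x m∣x∸y = begin
  x % m           ≡⟨ cong (_% m) (m∸n+n≡m y≤x) ⟨
  (x ∸ y + y) % m ≡⟨ %-remove-+ˡ y m∣x∸y ⟩
  y % m           ∎
  where open ≡-Reasoning

^-%≡1 : ∀ m x .{{_ : NonZero m}} → x % m ≡ 1 % m → ∀ c → x ^ c % m ≡ 1 % m
^-%≡1 m x x≡1 zero    = refl
^-%≡1 m x x≡1 (suc c) = begin
  (x * x ^ c) % m               ≡⟨ %-distribˡ-* x (x ^ c) m ⟩
  (x % m) * (x ^ c % m) % m     ≡⟨ cong₂ (λ u v → u * v % m) x≡1 (^-%≡1 m x x≡1 c) ⟩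
  (1 % m) * (1 % m) % m         ≡⟨ %-distribˡ-* 1 1 m ⟨
  1 % m                         ∎
  where open ≡-Reasoning

∣⇒^-%≡1 : ∀ m r {k e} .{{_ : NonZero m}} → r ^ k % m ≡ 1 % m → k ∣ e → r ^ e % m ≡ 1 % m
∣⇒^-%≡1 m r {k} rᵏ≡1 (divides c refl) = begin
  r ^ (c * k) % m ≡⟨ cong (λ e → r ^ e % m) (*-comm c k) ⟩
  r ^ (k * c) % m ≡⟨ cong (_% m) (^-*-assoc r k c) ⟨
  (r ^ k) ^ c % m ≡⟨ ^-%≡1 m (r ^ k) rᵏ≡1 c ⟩
  1 % m           ∎
  where open ≡-Reasoning

coprime-^ : ∀ {m r} → Coprime m r → ∀ a → Coprime m (r ^ a)
coprime-^ m⊥r zero    (_ , d∣1) = ∣1⇒≡1 d∣1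
coprime-^ {r = r} m⊥r (suc a) {d} (d∣m , d∣r*rᵃ) = coprime-^ m⊥r a (d∣m , coprime-divisor d⊥r d∣r*rᵃ)
  where
  d⊥r : Coprime d r
  d⊥r (e∣d , e∣r) = m⊥r (∣-trans e∣d d∣m , e∣r)

∃-period : ∀ m r .{{_ : NonZero m}} → 1 ≤ r → Coprime m r →
           Σ ℕ λ s → 1 ≤ s × s ≤ m × r ^ s % m ≡ 1 % m
∃-period m r r≥1 m⊥r with pigeonhole (n<1+n m) (λ i → fromℕ< (m%n<n (r ^ toℕ i) m))
... | i , j , i<j , resᵢ≡resⱼ = s , m<n⇒0<n∸m i<j , ≤-trans (m∸n≤m b a) (s≤s⁻¹ (toℕ<n j)) , rˢ≡1
  where
  a = toℕ i
  b = toℕ j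
  s = b ∸ a
  rᵇ≡rᵃ : r ^ b % m ≡ r ^ a % m
  rᵇ≡rᵃ = trans (sym (toℕ-fromℕ< _)) (trans (cong toℕ (sym resᵢ≡resⱼ)) (toℕ-fromℕ< _))
  rᵇ-rᵃ : r ^ b ∸ r ^ a ≡ r ^ a * (r ^ s ∸ 1)
  rᵇ-rᵃ = begin
    r ^ b ∸ r ^ a             ≡⟨ cong₂ _∸_ (cong (r ^_) (m+[n∸m]≡n (<⇒≤ i<j))) (*-identityʳ (r ^ a)) ⟨
    r ^ (a + s) ∸ r ^ a * 1   ≡⟨ cong (_∸ r ^ a * 1) (^-distribˡ-+-* r a s) ⟩
    r ^ a * r ^ s ∸ r ^ a * 1 ≡⟨ *-distribˡ-∸ (r ^ a) (r ^ s) 1 ⟨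
    r ^ a * (r ^ s ∸ 1)       ∎
    where open ≡-Reasoning
  m∣rˢ-1 : m ∣ r ^ s ∸ 1
  m∣rˢ-1 = coprime-divisor (coprime-^ m⊥r a) (subst (m ∣_) rᵇ-rᵃ (%≡⇒∣∸ m _ _ rᵇ≡rᵃ))
  rˢ≡1 : r ^ s % m ≡ 1 % m
  rˢ≡1 = ∣∸⇒%≡ m (m^n>0 r {{>-nonZero r≥1}} s) m∣rˢ-1

firstᵇ-sound : ∀ (P : ℕ → Bool) xs {x} → x ∈ xs → T (P x) → T (P (firstᵇ P xs)) × firstᵇ P xs ∈ xs
firstᵇ-sound P (y ∷ xs) x∈ Px with P y in Py
... | true = subst T (sym Py) _ , here refl
firstᵇ-sound P (y ∷ xs) (here refl) Px | false = ⊥-elim (subst T Py Px)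
firstᵇ-sound P (y ∷ xs) (there x∈) Px | false = let Pf , f∈ = firstᵇ-sound P xs x∈ Px in Pf , there f∈

∈-oneTo⁺ : ∀ {m s} → 1 ≤ s → s ≤ m → s ∈ oneTo m
∈-oneTo⁺ {s = suc _} _ s≤m = ∈-map⁺ suc (∈-upTo⁺ s≤m)

∈-oneTo⁻ : ∀ {m s} → s ∈ oneTo m → 1 ≤ s
∈-oneTo⁻ s∈ with _ , _ , refl ← ∈-map⁻ suc s∈ = s≤s z≤n

ord-spec : ∀ m r → 1 ≤ r → Coprime (suc m) r → 1 ≤ ord (suc m) r × r ^ ord (suc m) r % suc m ≡ 1 % suc m
ord-spec m r r≥1 m⊥r =
  let s , s≥1 , s≤m , rˢ≡1 = ∃-period (suc m) r r≥1 m⊥r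
      rᵏ≡1 , k∈ = firstᵇ-sound _ (oneTo (suc m)) (∈-oneTo⁺ s≥1 s≤m) (≡⇒≡ᵇ _ _ rˢ≡1)
  in ∈-oneTo⁻ k∈ , ≡ᵇ⇒≡ _ _ rᵏ≡1

k∣[m*k]//g : ∀ k {m g} → g ≢ 0 → g ∣ m → k ∣ (m * k) // g
k∣[m*k]//g k {g = zero}  g≢0 _   = contradiction refl g≢0
k∣[m*k]//g k {m} {suc g} _   g∣m = m*n∣o⇒m∣o/n k (suc g) (subst (k * suc g ∣_) (*-comm k m) (*-monoʳ-∣ k g∣m))

ord∣κ : ∀ m r t → ord (suc m) r ∣ κ (suc m) r t
ord∣κ m r t = k∣[m*k]//g (ord (suc m) r) (gcd[m,n]≢0 (suc m) tS (inj₁ λ ())) (gcd[m,n]∣m (suc m) tS)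
  where tS = t * Sgeom (ord (suc m) r) r

m∣n⇒gcd[n,m]≡m : ∀ {m n} → m ∣ n → gcd n m ≡ m
m∣n⇒gcd[n,m]≡m m∣n = GCD.unique (gcd-GCD _ _) (GCD.is (m∣n , ∣-refl) proj₂)

n//n≡1 : ∀ {n} → 1 ≤ n → n // n ≡ 1
n//n≡1 {suc n} _ = n/n≡1 (suc n)

Nbound-diagonal : ∀ m r t → 1 ≤ r → Coprime (suc m) r → Nbound (suc m) (suc m) r t ≡ 1
Nbound-diagonal m r t r≥1 m⊥r = begin
  k // gcd (κ (suc m) r t) k ≡⟨ cong (k //_) (m∣n⇒gcd[n,m]≡m (ord∣κ m r t)) ⟩
  k // k                     ≡⟨ n//n≡1 (proj₁ (ord-spec m r r≥1 m⊥r)) ⟩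
  1                          ∎
  where
  open ≡-Reasoning
  k = ord (suc m) r

filterᵇ-divisors-of-1 : ∀ N (P : ℕ → Bool) → N ≡ 1 → T (P 1) →
                        filterᵇ (λ ℓ → (ℓ ∣ᵇ N) ∧ P ℓ) (oneTo N) ≡ 1 ∷ []
filterᵇ-divisors-of-1 .1 P refl P1 with P 1
... | true = refl

Λ-diagonal : ∀ m r t → 1 ≤ r → Coprime (suc m) r → Λ (suc m) (suc m) r t ≡ 1 ∷ []
Λ-diagonal m r t r≥1 m⊥r =
  filterᵇ-divisors-of-1 (Nbound n n r t) (λ ℓ → gcd (r ^ (ℓ * κ n r t) ∸ 1) n ≡ᵇ n)
    (Nbound-diagonal m r t r≥1 m⊥r) (≡⇒≡ᵇ _ _ (m∣n⇒gcd[n,m]≡m n∣rᵏ-1))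
  where
  n = suc m
  rᵏ≡1 : r ^ (1 * κ n r t) % n ≡ 1 % n
  rᵏ≡1 = ∣⇒^-%≡1 n r (proj₂ (ord-spec m r r≥1 m⊥r)) (∣-trans (ord∣κ m r t) (∣-reflexive (sym (*-identityˡ (κ n r t)))))
  n∣rᵏ-1 : n ∣ r ^ (1 * κ n r t) ∸ 1
  n∣rᵏ-1 = %≡⇒∣∸ n (r ^ (1 * κ n r t)) 1 rᵏ≡1

𝒮-diagonal : ∀ m r t → 1 ≤ r → Coprime (suc m) r → 𝒮 (suc m) (suc m) r t ≡ suc m
𝒮-diagonal m r t r≥1 m⊥r = begin
  𝒮 n n r t                              ≡⟨ cong (sum ∘ map term) (Λ-diagonal m r t r≥1 m⊥r) ⟩
  n * φ (k // (1 * gcd (κ n r t) k)) + 0 ≡⟨ cong (λ g → n * φ (k // g) + 0) (*-identityˡ (gcd (κ n r t) k)) ⟩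
  n * φ (Nbound n n r t) + 0             ≡⟨ cong (λ N → n * φ N + 0) (Nbound-diagonal m r t r≥1 m⊥r) ⟩
  n * φ 1 + 0                            ≡⟨ trans (+-identityʳ (n * 1)) (*-identityʳ n) ⟩
  n                                      ∎
  where
  open ≡-Reasoning
  n = suc m
  k = ord n r
  term = λ ℓ → n * φ (k // (ℓ * gcd (κ n r t) k))

lemma5p6 : (p : ℕ) → Prime p → 3 < p →
           (t : ℕ) → (t ≡ 1 ⊎ t ≡ 3 ⊎ t ≡ p ⊎ t ≡ 3 * p) →
           (r : ℕ) → 1 ≤ r → r ≤ 3 * p ∸ 1 → gcd r (3 * p) ≡ 1 →
           𝒮 (3 * p) (3 * p) r t ≡ 3 * p
lemma5p6 (suc _) _ _ t _ r r≥1 _ gcd[r,3p]≡1 =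
  𝒮-diagonal _ r t r≥1 (Coprimality.sym (gcd≡1⇒coprime gcd[r,3p]≡1))
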